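{- Let $m,n\ge 1$ be integers, let $G=T_{2m+1,2n+1}=C_{2m+1}\Box C_{2n+1}$, let $N=(2m+1)(2n+1)$, label the vertices of $G$ by $1,\ldots,N$ and let $f_G(x_1,\ldots,x_N)=\prod_{1\le i<j\le N,\ ij\in E(G)}(x_i-x_j)$ be its graph polynomial. Then the coefficient of $\prod_{i=1}^N x_i^2$ in $f_G$ is $0$.
   Context: $C_k$ is the cycle on $k$ vertices; $C_a\Box C_b$ is the Cartesian product (vertex set $V(C_a)\times V(C_b)$, $(u_1,v_1)\sim(u_2,v_2)$ iff either $u_1=u_2$ and $v_1v_2$ is an edge, or $v_1=v_2$ and $u_1u_2$ is an edge), called the toroidal grid $T_{a,b}$. -}

module Defs where

open import Data.Nat as ℕ using (ℕ; zero; suc; _%_)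
open import Data.Integer as ℤ using (ℤ)
open import Data.Fin as Fin using (Fin; toℕ; remQuot)
open import Data.Fin.Properties using (_≟_)
open import Data.Vec as Vec using (Vec; replicate; zipWith; updateAt)
open import Data.Vec.Properties using (≡-dec)
open import Data.List as List using (List; []; _∷_; _++_; map; concatMap; filter; allFin; foldr)
open import Data.Product using (_×_; _,_; proj₁; proj₂)
open import Data.Sum using (_⊎_)
open import Relation.Nullary using (Dec; yes; no)
open import Relation.Nullary.Decidable using (_⊎-dec_; _×-dec_)
open import Relation.Binary.PropositionalEquality using (_≡_)
import Data.Nat.Properties as ℕP

-- Multivariate polynomials over ℤ in variables x_0,…,x_{N-1},
-- represented as formal sums (lists) of terms  c · x^e  where the
-- exponent vector e : Vec ℕ N.  (Not normalised; the coefficient of a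
-- monomial is the sum of the coefficients of all terms with that exponent.)

Monomial : ℕ → Set
Monomial N = Vec ℕ N

Poly : ℕ → Set
Poly N = List (ℤ × Monomial N)

oneP : ∀ {N} → Poly N
oneP = (ℤ.+ 1 , replicate _ 0) ∷ []

varP : ∀ {N} → Fin N → Poly N
varP i = (ℤ.+ 1 , updateAt (replicate _ 0) i (λ _ → 1)) ∷ []

negP : ∀ {N} → Poly N → Poly N
negP = map (λ t → ℤ.- proj₁ t , proj₂ t)

_+P_ : ∀ {N} → Poly N → Poly N → Poly N
p +P q = p ++ q

_-P_ : ∀ {N} → Poly N → Poly N → Poly N
p -P q = p +P negP q

_*P_ : ∀ {N} → Poly N → Poly N → Poly N
p *P q = concatMap (λ s → map (λ t → proj₁ s ℤ.* proj₁ t , zipWith ℕ._+_ (proj₂ s) (proj₂ t)) q) p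

coeff : ∀ {N} → Monomial N → Poly N → ℤ
coeff e [] = ℤ.+ 0
coeff e ((c , e') ∷ p) with ≡-dec ℕP._≟_ e' e
... | yes _ = c ℤ.+ coeff e p
... | no  _ = coeff e p

-- Graphs on the vertex set Fin N = {0,…,N-1} (i.e. labelled 1..N)
-- given by a decidable adjacency relation.

edgeList : ∀ {N} (adj : Fin N → Fin N → Set) →
           (∀ i j → Dec (adj i j)) → List (Fin N × Fin N)
edgeList {N} adj adj? =
  concatMap (λ i → map (λ j → i , j)
    (filter (λ j → (i Fin.<? j) ×-dec adj? i j) (allFin N)))
    (allFin N)

graphPoly : ∀ {N} (adj : Fin N → Fin N → Set) →
            (∀ i j → Dec (adj i j)) → Poly N
graphPoly adj adj? =
  foldr (λ e acc → (varP (proj₁ e) -P varP (proj₂ e)) *P acc) oneP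
        (edgeList adj adj?)

CycleAdj : (k : ℕ) → Fin k → Fin k → Set
CycleAdj k u v = (toℕ v ≡ (suc (toℕ u)) % suc (k ℕ.∸ 1)) ⊎ (toℕ u ≡ (suc (toℕ v)) % suc (k ℕ.∸ 1))

cycleAdj? : (k : ℕ) → ∀ u v → Dec (CycleAdj k u v)
cycleAdj? k u v = (toℕ v ℕP.≟ _) ⊎-dec (toℕ u ℕP.≟ _)

TorusAdj' : (a b : ℕ) → Fin a × Fin b → Fin a × Fin b → Set
TorusAdj' a b (u₁ , v₁) (u₂ , v₂) =
  (u₁ ≡ u₂ × CycleAdj b v₁ v₂) ⊎ (v₁ ≡ v₂ × CycleAdj a u₁ u₂)

torusAdj'? : (a b : ℕ) → ∀ x y → Dec (TorusAdj' a b x y)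
torusAdj'? a b (u₁ , v₁) (u₂ , v₂) =
  ((u₁ ≟ u₂) ×-dec cycleAdj? b v₁ v₂) ⊎-dec ((v₁ ≟ v₂) ×-dec cycleAdj? a u₁ u₂)

-- Toroidal grid T_{a,b} with vertices labelled by Fin (a*b)
-- via the bijection remQuot : Fin (a * b) → Fin a × Fin b.
TorusAdj : (a b : ℕ) → Fin (a ℕ.* b) → Fin (a ℕ.* b) → Set
TorusAdj a b i j = TorusAdj' a b (remQuot b i) (remQuot b j)

torusAdj? : (a b : ℕ) → ∀ i j → Dec (TorusAdj a b i j)
torusAdj? a b i j = torusAdj'? a b (remQuot b i) (remQuot b j)

torusPoly : (a b : ℕ) → Poly (a ℕ.* b)
torusPoly a b = graphPoly (TorusAdj a b) (torusAdj? a b)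

-- Let σ reflect every row cycle of T_{a,b}. It is a graph automorphism fixing the monomial
-- x_1^2 ⋯ x_N^2, and it permutes the factors x_i - x_j of f_G up to sign: a factor changes sign
-- exactly when its edge lies inside a row, and there is one such edge per vertex. So the
-- coefficient c satisfies c = (-1)^(ab) c, hence c = 0 when ab is odd.

module Submission where

open import Defs
open import Data.Nat using (ℕ; _≥_; _+_; _*_)
open import Data.Integer using (ℤ)
open import Data.Vec using (replicate)
open import Relation.Binary.PropositionalEquality using (_≡_)

open import Data.Bool using (true; false)
open import Data.Empty using (⊥-elim)
open import Data.Fin using (Fin; toℕ; _<_; _<?_; combine; remQuot; opposite; fromℕ<)
open import Data.Fin.Properties
  using (_≟_; <-cmp; <-irrefl; <-asym; toℕ<n; toℕ-injective; toℕ-fromℕ<; toℕ-combine; combine-monoˡ-<;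
         combine-remQuot; remQuot-combine; opposite-prop; opposite-involutive)
open import Data.Integer using (+_; -_; -[1+_]; _-_; -1ℤ; _^_) renaming (_+_ to _+ℤ_; _*_ to _*ℤ_)
import Data.Integer.Properties as ℤₚ
import Data.Integer.Tactic.RingSolver as ℤ-Solver
open import Data.List
  using (List; []; _∷_; _++_; map; foldr; filter; length; allFin; concatMap; cartesianProduct)
open import Data.List.Properties using (filter-++; map-∘; length-map; length-tabulate)
open import Data.List.Membership.Propositional using (_∈_)
open import Data.List.Membership.Propositional.Properties
  using (∈-filter⁺; ∈-filter⁻; ∈-allFin; ∈-cartesianProduct⁺; ∈-map⁺; ∈-map⁻)
open import Data.List.Membership.Propositional.Properties.WithK using (unique∧set⇒bag)
open import Data.List.Relation.Binary.BagAndSetEquality using (∼bag⇒↭)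
open import Data.List.Relation.Binary.Permutation.Propositional using (_↭_)
import Data.List.Relation.Binary.Permutation.Propositional as ↭
open import Data.List.Relation.Binary.Permutation.Propositional.Properties using (↭-length)
open import Data.List.Relation.Unary.Unique.Propositional using (Unique)
open import Data.List.Relation.Unary.Unique.Propositional.Properties
  using (filter⁺; map⁺; cartesianProduct⁺; allFin⁺)
open import Data.Nat as ℕ using (zero; suc; _%_; _∸_; _≤_; s≤s; z≤n)
import Data.Nat.Properties as ℕₚ
open import Data.Nat.DivMod using (m%n<n; m<n⇒m%n≡m; n%n≡0)
import Data.Nat.Tactic.RingSolver as ℕ-Solver
open import Data.Product using (_×_; _,_; proj₁; proj₂; uncurry) renaming (swap to flip; map to map×)
open import Data.Sum using (_⊎_; inj₁; inj₂)
open import Data.Vec using (zipWith; updateAt; lookup; tabulate)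
open import Data.Vec.Properties
  using (≡-dec; tabulate∘lookup; tabulate-cong; lookup∘tabulate; lookup∘updateAt; lookup∘updateAt′;
         updateAt-commutes; lookup-zipWith; lookup-replicate)
open import Function using (_∘_)
open import Function.Bundles using (mk⇔)
open import Relation.Binary.Definitions using (tri<; tri≈; tri>)
open import Relation.Binary.PropositionalEquality
  using (_≢_; refl; sym; trans; cong; cong₂; subst; subst₂; module ≡-Reasoning)
open import Relation.Nullary using (Dec; yes; no; does)
open import Relation.Nullary.Decidable using (_×-dec_; _⊎-dec_)

-- Coefficients of products of binomials x_i - x_j

lookup-ext : ∀ {N} {d e : Monomial N} → (∀ k → lookup d k ≡ lookup e k) → d ≡ e
lookup-ext {d = d} {e} eq =
  trans (sym (tabulate∘lookup d)) (trans (tabulate-cong eq) (tabulate∘lookup e))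

lower : ∀ {N} → Monomial N → Fin N → Monomial N
lower d i = updateAt d i ℕ.pred

unitExp : ∀ {N} → Fin N → Monomial N
unitExp i = updateAt (replicate _ 0) i (λ _ → 1)

module _ {N} (d : Monomial N) (i : Fin N) where

  lookup-lower-self : lookup (lower d i) i ≡ ℕ.pred (lookup d i)
  lookup-lower-self = lookup∘updateAt i d

  lookup-lower-other : ∀ k → k ≢ i → lookup (lower d i) k ≡ lookup d k
  lookup-lower-other k k≢i = lookup∘updateAt′ k i k≢i d

module _ {N} (i : Fin N) where

  lookup-unitExp-self : lookup (unitExp i) i ≡ 1
  lookup-unitExp-self = lookup∘updateAt i (replicate _ 0)

  lookup-unitExp-other : ∀ k → k ≢ i → lookup (unitExp i) k ≡ 0
  lookup-unitExp-other k k≢i = trans (lookup∘updateAt′ k i k≢i (replicate _ 0)) (lookup-replicate k 0)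

  lookup-unitExp+-self : ∀ e → lookup (zipWith ℕ._+_ (unitExp i) e) i ≡ suc (lookup e i)
  lookup-unitExp+-self e =
    trans (lookup-zipWith ℕ._+_ i (unitExp i) e) (cong (ℕ._+ lookup e i) lookup-unitExp-self)

  lookup-unitExp+-other : ∀ e k → k ≢ i → lookup (zipWith ℕ._+_ (unitExp i) e) k ≡ lookup e k
  lookup-unitExp+-other e k k≢i =
    trans (lookup-zipWith ℕ._+_ k (unitExp i) e) (cong (ℕ._+ lookup e k) (lookup-unitExp-other k k≢i))

  lower-unitExp+ : ∀ e → lower (zipWith ℕ._+_ (unitExp i) e) i ≡ e
  lower-unitExp+ e = lookup-ext pointwise
    where
    d = zipWith ℕ._+_ (unitExp i) e
    pointwise : ∀ k → lookup (lower d i) k ≡ lookup e k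
    pointwise k with k ≟ i
    ... | yes refl = trans (lookup-lower-self d i) (cong ℕ.pred (lookup-unitExp+-self e))
    ... | no k≢i   = trans (lookup-lower-other d i k k≢i) (lookup-unitExp+-other e k k≢i)

  unitExp+-lower : ∀ d {n} → lookup d i ≡ suc n → zipWith ℕ._+_ (unitExp i) (lower d i) ≡ d
  unitExp+-lower d {n} dᵢ≡1+n = lookup-ext pointwise
    where
    pointwise : ∀ k → lookup (zipWith ℕ._+_ (unitExp i) (lower d i)) k ≡ lookup d k
    pointwise k with k ≟ i
    ... | yes refl = trans (lookup-unitExp+-self (lower d i))
                           (trans (cong suc (trans (lookup-lower-self d i) (cong ℕ.pred dᵢ≡1+n))) (sym dᵢ≡1+n))
    ... | no k≢i   = trans (lookup-unitExp+-other (lower d i) k k≢i) (lookup-lower-other d i k k≢i)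

coeff-++ : ∀ {N} (d : Monomial N) p q → coeff d (p ++ q) ≡ coeff d p +ℤ coeff d q
coeff-++ d [] q = sym (ℤₚ.+-identityˡ _)
coeff-++ d ((c , e) ∷ p) q with ≡-dec ℕₚ._≟_ e d
... | yes _ = trans (cong (c +ℤ_) (coeff-++ d p q)) (sym (ℤₚ.+-assoc c _ _))
... | no _  = coeff-++ d p q

mulTerm : ∀ {N} → ℤ × Monomial N → ℤ × Monomial N → ℤ × Monomial N
mulTerm s t = proj₁ s *ℤ proj₁ t , zipWith ℕ._+_ (proj₂ s) (proj₂ t)

-- ifPositive (d i) z is the coefficient of x^d in x_i · p, where z is that of x^(d - e_i) in p.
ifPositive : ℕ → ℤ → ℤ
ifPositive zero    _ = + 0
ifPositive (suc _) z = z

module _ {N} (d : Monomial N) (i : Fin N) (c : ℤ) where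

  coeff-mulVar-absent : ∀ q → lookup d i ≡ 0 → coeff d (map (mulTerm (c , unitExp i)) q) ≡ + 0
  coeff-mulVar-absent []             dᵢ≡0 = refl
  coeff-mulVar-absent ((_ , e) ∷ q) dᵢ≡0 with ≡-dec ℕₚ._≟_ (zipWith ℕ._+_ (unitExp i) e) d
  ... | yes refl with () ← trans (sym dᵢ≡0) (lookup-unitExp+-self i e)
  ... | no _     = coeff-mulVar-absent q dᵢ≡0

  coeff-mulVar-present : ∀ q {n} → lookup d i ≡ suc n →
                         coeff d (map (mulTerm (c , unitExp i)) q) ≡ c *ℤ coeff (lower d i) q
  coeff-mulVar-present []             dᵢ≡1+n = sym (ℤₚ.*-zeroʳ c)
  coeff-mulVar-present ((c′ , e) ∷ q) dᵢ≡1+n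
    with ≡-dec ℕₚ._≟_ (zipWith ℕ._+_ (unitExp i) e) d | ≡-dec ℕₚ._≟_ e (lower d i)
  ... | yes _    | yes _ = trans (cong (c *ℤ c′ +ℤ_) (coeff-mulVar-present q dᵢ≡1+n))
                                   (sym (ℤₚ.*-distribˡ-+ c c′ _))
  ... | yes refl | no e≢ = ⊥-elim (e≢ (sym (lower-unitExp+ i e)))
  ... | no ≢d    | yes refl = ⊥-elim (≢d (unitExp+-lower i d dᵢ≡1+n))
  ... | no _     | no _ = coeff-mulVar-present q dᵢ≡1+n

  coeff-mulVar : ∀ q → coeff d (map (mulTerm (c , unitExp i)) q)
                     ≡ c *ℤ ifPositive (lookup d i) (coeff (lower d i) q)
  coeff-mulVar q with lookup d i in dᵢ
  ... | zero  = trans (coeff-mulVar-absent q dᵢ) (sym (ℤₚ.*-zeroʳ c))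
  ... | suc _ = coeff-mulVar-present q dᵢ

binomialProduct : ∀ {N} → List (Fin N × Fin N) → Poly N
binomialProduct = foldr (λ e acc → (varP (proj₁ e) -P varP (proj₂ e)) *P acc) oneP

-- The coefficient of x^d in ∏_{(i , j) ∈ L} (x_i - x_j), by expanding the first factor.
edgeCoeff : ∀ {N} → Monomial N → List (Fin N × Fin N) → ℤ
edgeCoeff d []            = coeff d oneP
edgeCoeff d ((i , j) ∷ L) = ifPositive (lookup d i) (edgeCoeff (lower d i) L)
                          - ifPositive (lookup d j) (edgeCoeff (lower d j) L)

coeff-binomialProduct : ∀ {N} (d : Monomial N) L → coeff d (binomialProduct L) ≡ edgeCoeff d L
coeff-binomialProduct d [] = refl
coeff-binomialProduct d ((i , j) ∷ L) = begin
  coeff d (xᵢq ++ (-xⱼq ++ []))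
    ≡⟨ coeff-++ d xᵢq (-xⱼq ++ []) ⟩
  coeff d xᵢq +ℤ coeff d (-xⱼq ++ [])
    ≡⟨ cong (coeff d xᵢq +ℤ_) (trans (coeff-++ d -xⱼq []) (ℤₚ.+-identityʳ _)) ⟩
  coeff d xᵢq +ℤ coeff d -xⱼq
    ≡⟨ cong₂ _+ℤ_ (coeff-mulVar d i (+ 1) q) (coeff-mulVar d j -1ℤ q) ⟩
  + 1 *ℤ xᵢ +ℤ -1ℤ *ℤ xⱼ
    ≡⟨ cong₂ _+ℤ_ (ℤₚ.*-identityˡ xᵢ) (ℤₚ.-1*i≡-i xⱼ) ⟩
  xᵢ - xⱼ
    ≡⟨ cong₂ (λ x y → ifPositive (lookup d i) x - ifPositive (lookup d j) y)
             (coeff-binomialProduct (lower d i) L) (coeff-binomialProduct (lower d j) L) ⟩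
  edgeCoeff d ((i , j) ∷ L) ∎
  where
  open ≡-Reasoning
  q = binomialProduct L
  xᵢq = map (mulTerm (+ 1 , unitExp i)) q
  -xⱼq = map (mulTerm (-1ℤ , unitExp j)) q
  xᵢ = ifPositive (lookup d i) (coeff (lower d i) q)
  xⱼ = ifPositive (lookup d j) (coeff (lower d j) q)

ifPositive-sub : ∀ n a b → ifPositive n (a - b) ≡ ifPositive n a - ifPositive n b
ifPositive-sub zero    a b = refl
ifPositive-sub (suc n) a b = refl

ifPositive-scale : ∀ n s a → ifPositive n (s *ℤ a) ≡ s *ℤ ifPositive n a
ifPositive-scale zero    s a = sym (ℤₚ.*-zeroʳ s)
ifPositive-scale (suc n) s a = refl

ifPositive-comm : ∀ m n z → ifPositive m (ifPositive n z) ≡ ifPositive n (ifPositive m z)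
ifPositive-comm zero    zero    z = refl
ifPositive-comm zero    (suc n) z = refl
ifPositive-comm (suc m) zero    z = refl
ifPositive-comm (suc m) (suc n) z = refl

lower-comm : ∀ {N} (d : Monomial N) i j → lower (lower d i) j ≡ lower (lower d j) i
lower-comm d i j with i ≟ j
... | yes refl = refl
... | no i≢j   = updateAt-commutes j i (i≢j ∘ sym) d

edgeCoeff₂ : ∀ {N} → Monomial N → Fin N → Fin N → List (Fin N × Fin N) → ℤ
edgeCoeff₂ d i k L =
  ifPositive (lookup d i) (ifPositive (lookup (lower d i) k) (edgeCoeff (lower (lower d i) k) L))

edgeCoeff₂-comm : ∀ {N} (d : Monomial N) i k L → edgeCoeff₂ d i k L ≡ edgeCoeff₂ d k i L
edgeCoeff₂-comm d i k L with i ≟ k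
... | yes refl = refl
... | no i≢k
  rewrite lookup-lower-other d i k (i≢k ∘ sym) | lookup-lower-other d k i i≢k | lower-comm d i k
  = ifPositive-comm (lookup d i) (lookup d k) _

edgeCoeff-expand₂ : ∀ {N} (d : Monomial N) i j k l L →
                    edgeCoeff d ((i , j) ∷ (k , l) ∷ L)
                  ≡ (edgeCoeff₂ d i k L - edgeCoeff₂ d i l L) - (edgeCoeff₂ d j k L - edgeCoeff₂ d j l L)
edgeCoeff-expand₂ d i j k l L =
  cong₂ _-_ (ifPositive-sub (lookup d i) _ _) (ifPositive-sub (lookup d j) _ _)

-- Expanding two factors gives four terms edgeCoeff₂ d p q L, each symmetric in p and q.
edgeCoeff-swap : ∀ {N} (d : Monomial N) x y L → edgeCoeff d (x ∷ y ∷ L) ≡ edgeCoeff d (y ∷ x ∷ L)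
edgeCoeff-swap d (i , j) (k , l) L
  rewrite edgeCoeff-expand₂ d i j k l L | edgeCoeff-expand₂ d k l i j L
        | edgeCoeff₂-comm d i k L | edgeCoeff₂-comm d i l L
        | edgeCoeff₂-comm d j k L | edgeCoeff₂-comm d j l L
  = exchange (edgeCoeff₂ d k i L) (edgeCoeff₂ d l i L) (edgeCoeff₂ d k j L) (edgeCoeff₂ d l j L)
  where
  exchange : ∀ a b c e → (a - b) - (c - e) ≡ (a - c) - (b - e)
  exchange = ℤ-Solver.solve-∀

edgeCoeff-∷-cong : ∀ {N} {L L′ : List (Fin N × Fin N)} →
                   (∀ d → edgeCoeff d L ≡ edgeCoeff d L′) →
                   ∀ x d → edgeCoeff d (x ∷ L) ≡ edgeCoeff d (x ∷ L′)
edgeCoeff-∷-cong eq (i , j) d =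
  cong₂ (λ x y → ifPositive (lookup d i) x - ifPositive (lookup d j) y) (eq (lower d i)) (eq (lower d j))

edgeCoeff-↭ : ∀ {N} {L L′ : List (Fin N × Fin N)} → L ↭ L′ →
              ∀ d → edgeCoeff d L ≡ edgeCoeff d L′
edgeCoeff-↭ ↭.refl d = refl
edgeCoeff-↭ {L = _ ∷ L} {_ ∷ L′} (↭.prep x p) d = edgeCoeff-∷-cong {L = L} {L′} (edgeCoeff-↭ p) x d
edgeCoeff-↭ {L = _ ∷ _ ∷ L} {_ ∷ _ ∷ L′} (↭.swap x y p) d =
  trans (edgeCoeff-swap d x y L)
        (edgeCoeff-∷-cong {L = x ∷ L} {x ∷ L′} (edgeCoeff-∷-cong {L = L} {L′} (edgeCoeff-↭ p) x) y d)
edgeCoeff-↭ (↭.trans p q) d = trans (edgeCoeff-↭ p d) (edgeCoeff-↭ q d)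

edgeCoeff-flip : ∀ {N} (d : Monomial N) x L → edgeCoeff d (flip x ∷ L) ≡ - edgeCoeff d (x ∷ L)
edgeCoeff-flip d (i , j) L = antisym (ifPositive (lookup d i) (edgeCoeff (lower d i) L))
                                     (ifPositive (lookup d j) (edgeCoeff (lower d j) L))
  where
  antisym : ∀ a b → b - a ≡ - (a - b)
  antisym = ℤ-Solver.solve-∀

edgeCoeff-∷-scale : ∀ {N} {L L′ : List (Fin N × Fin N)} s →
                    (∀ d → edgeCoeff d L ≡ s *ℤ edgeCoeff d L′) →
                    ∀ x d → edgeCoeff d (x ∷ L) ≡ s *ℤ edgeCoeff d (x ∷ L′)
edgeCoeff-∷-scale {L′ = L′} s eq (i , j) d
  rewrite eq (lower d i) | eq (lower d j)
        | ifPositive-scale (lookup d i) s (edgeCoeff (lower d i) L′)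
        | ifPositive-scale (lookup d j) s (edgeCoeff (lower d j) L′)
  = factor s _ _
  where
  factor : ∀ s a b → s *ℤ a - s *ℤ b ≡ s *ℤ (a - b)
  factor = ℤ-Solver.solve-∀

swapWhen : ∀ {A : Set} {P : A × A → Set} → (∀ x → Dec (P x)) → A × A → A × A
swapWhen P? x with P? x
... | yes _ = flip x
... | no  _ = x

edgeCoeff-swapWhen : ∀ {N} {P : Fin N × Fin N → Set} (P? : ∀ x → Dec (P x)) L d →
                     edgeCoeff d (map (swapWhen P?) L) ≡ -1ℤ ^ length (filter P? L) *ℤ edgeCoeff d L
edgeCoeff-swapWhen P? []      d = sym (ℤₚ.*-identityˡ _)
edgeCoeff-swapWhen P? (x ∷ L) d with P? x
... | no  _ =
  edgeCoeff-∷-scale {L = map (swapWhen P?) L} {L} (-1ℤ ^ length (filter P? L)) (edgeCoeff-swapWhen P? L) x d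
... | yes _ = begin
  edgeCoeff d (flip x ∷ L′)     ≡⟨ edgeCoeff-flip d x L′ ⟩
  - edgeCoeff d (x ∷ L′)        ≡⟨ cong -_ (edgeCoeff-∷-scale {L = L′} {L} s (edgeCoeff-swapWhen P? L) x d) ⟩
  - (s *ℤ edgeCoeff d (x ∷ L))  ≡⟨ ℤₚ.neg-distribˡ-* s _ ⟩
  - s *ℤ edgeCoeff d (x ∷ L)    ≡⟨ cong (_*ℤ edgeCoeff d (x ∷ L)) (sym (ℤₚ.-1*i≡-i s)) ⟩
  -1ℤ *ℤ s *ℤ edgeCoeff d (x ∷ L) ∎
  where
  open ≡-Reasoning
  L′ = map (swapWhen P?) L
  s = -1ℤ ^ length (filter P? L)

-- Renaming variables and graph automorphisms

module Renaming {N} (σ τ : Fin N → Fin N)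
                (τ∘σ : ∀ i → τ (σ i) ≡ i) (σ∘τ : ∀ k → σ (τ k) ≡ k) where

  rename : Monomial N → Monomial N
  rename d = tabulate (lookup d ∘ τ)

  lookup-rename : ∀ d k → lookup (rename d) k ≡ lookup d (τ k)
  lookup-rename d = lookup∘tabulate (lookup d ∘ τ)

  lookup-rename-σ : ∀ d i → lookup (rename d) (σ i) ≡ lookup d i
  lookup-rename-σ d i = trans (lookup-rename d (σ i)) (cong (lookup d) (τ∘σ i))

  rename-replicate : ∀ c → rename (replicate N c) ≡ replicate N c
  rename-replicate c = lookup-ext λ k →
    trans (lookup-rename (replicate N c) k) (trans (lookup-replicate (τ k) c) (sym (lookup-replicate k c)))

  rename-injective : ∀ {d e} → rename d ≡ rename e → d ≡ e
  rename-injective {d} {e} eq = lookup-ext λ i →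
    trans (sym (lookup-rename-σ d i)) (trans (cong (λ v → lookup v (σ i)) eq) (lookup-rename-σ e i))

  ≢σ⇒τ≢ : ∀ {k i} → k ≢ σ i → τ k ≢ i
  ≢σ⇒τ≢ {k} k≢σi τk≡i = k≢σi (trans (sym (σ∘τ k)) (cong σ τk≡i))

  lower-rename : ∀ d i → lower (rename d) (σ i) ≡ rename (lower d i)
  lower-rename d i = lookup-ext pointwise
    where
    pointwise : ∀ k → lookup (lower (rename d) (σ i)) k ≡ lookup (rename (lower d i)) k
    pointwise k with k ≟ σ i
    ... | yes refl rewrite lookup-lower-self (rename d) (σ i) | lookup-rename (lower d i) (σ i) | τ∘σ i
                         | lookup-lower-self d i | lookup-rename d (σ i) | τ∘σ i = refl
    ... | no k≢σi rewrite lookup-lower-other (rename d) (σ i) k k≢σi | lookup-rename (lower d i) k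
                        | lookup-lower-other d i (τ k) (≢σ⇒τ≢ k≢σi)
                        = lookup-rename d k

  coeff-oneP-rename : ∀ d → coeff (rename d) oneP ≡ coeff d oneP
  coeff-oneP-rename d with ≡-dec ℕₚ._≟_ (replicate N 0) (rename d) | ≡-dec ℕₚ._≟_ (replicate N 0) d
  ... | yes _  | yes _  = refl
  ... | no  _  | no  _  = refl
  ... | yes 0≡ | no 0≢  = ⊥-elim (0≢ (rename-injective (trans (rename-replicate 0) 0≡)))
  ... | no 0≢  | yes 0≡ = ⊥-elim (0≢ (trans (sym (rename-replicate 0)) (cong rename 0≡)))

  edgeCoeff-rename : ∀ L d → edgeCoeff (rename d) (map (map× σ σ) L) ≡ edgeCoeff d L
  edgeCoeff-rename []            d = coeff-oneP-rename d
  edgeCoeff-rename ((i , j) ∷ L) d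
    rewrite lookup-rename-σ d i | lookup-rename-σ d j | lower-rename d i | lower-rename d j
          | edgeCoeff-rename L (lower d i) | edgeCoeff-rename L (lower d j) = refl

filter-map : ∀ {A B : Set} {P : B → Set} (P? : ∀ y → Dec (P y)) (f : A → B) xs →
             filter P? (map f xs) ≡ map f (filter (P? ∘ f) xs)
filter-map P? f []       = refl
filter-map P? f (x ∷ xs) with does (P? (f x))
... | true  = cong (f x ∷_) (filter-map P? f xs)
... | false = filter-map P? f xs

map-involution-↭ : ∀ {A : Set} {g : A → A} {xs : List A} → (∀ x → g (g x) ≡ x) →
                   Unique xs → (∀ {x} → x ∈ xs → g x ∈ xs) → map g xs ↭ xs
map-involution-↭ {g = g} {xs} g∘g unique g-closed =
  ∼bag⇒↭ (unique∧set⇒bag (map⁺ g-injective unique) unique (mk⇔ image⊆xs xs⊆image))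
  where
  g-injective : ∀ {x y} → g x ≡ g y → x ≡ y
  g-injective {x} {y} gx≡gy = trans (sym (g∘g x)) (trans (cong g gx≡gy) (g∘g y))

  image⊆xs : ∀ {y} → y ∈ map g xs → y ∈ xs
  image⊆xs y∈ with ∈-map⁻ g y∈
  ... | x , x∈ , refl = g-closed x∈

  xs⊆image : ∀ {y} → y ∈ xs → y ∈ map g xs
  xs⊆image {y} y∈ = subst (_∈ map g xs) (g∘g y) (∈-map⁺ g (g-closed y∈))

module EdgeList {N} (adj : Fin N → Fin N → Set) (adj? : ∀ i j → Dec (adj i j)) where

  IsEdge : Fin N × Fin N → Set
  IsEdge (i , j) = i < j × adj i j

  isEdge? : ∀ x → Dec (IsEdge x)
  isEdge? (i , j) = (i <? j) ×-dec adj? i j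

  edgeList-filter : ∀ xs ys → concatMap (λ i → map (i ,_) (filter (isEdge? ∘ (i ,_)) ys)) xs
                            ≡ filter isEdge? (cartesianProduct xs ys)
  edgeList-filter []       ys = refl
  edgeList-filter (x ∷ xs) ys = begin
    map (x ,_) (filter (isEdge? ∘ (x ,_)) ys) ++ _
      ≡⟨ cong₂ _++_ (sym (filter-map isEdge? (x ,_) ys)) (edgeList-filter xs ys) ⟩
    filter isEdge? (map (x ,_) ys) ++ filter isEdge? (cartesianProduct xs ys)
      ≡⟨ sym (filter-++ isEdge? (map (x ,_) ys) _) ⟩
    filter isEdge? (cartesianProduct (x ∷ xs) ys) ∎
    where open ≡-Reasoning

  edges : List (Fin N × Fin N)
  edges = edgeList adj adj?

  edges-filter : edges ≡ filter isEdge? (cartesianProduct (allFin N) (allFin N))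
  edges-filter = edgeList-filter (allFin N) (allFin N)

  edges-unique : Unique edges
  edges-unique rewrite edges-filter = filter⁺ isEdge? (cartesianProduct⁺ (allFin⁺ N) (allFin⁺ N))

  ∈-edges⁺ : ∀ {i j} → i < j → adj i j → (i , j) ∈ edges
  ∈-edges⁺ {i} {j} i<j ij rewrite edges-filter =
    ∈-filter⁺ isEdge? (∈-cartesianProduct⁺ (∈-allFin i) (∈-allFin j)) (i<j , ij)

  ∈-edges⁻ : ∀ {x} → x ∈ edges → IsEdge x
  ∈-edges⁻ x∈ rewrite edges-filter =
    proj₂ (∈-filter⁻ isEdge? {xs = cartesianProduct (allFin N) (allFin N)} x∈)

module Reflection {N} (adj : Fin N → Fin N → Set) (adj? : ∀ i j → Dec (adj i j))
                  (adj-sym : ∀ {i j} → adj i j → adj j i)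
                  (σ : Fin N → Fin N) (σ-involutive : ∀ i → σ (σ i) ≡ i)
                  (σ-adj : ∀ {i j} → adj i j → adj (σ i) (σ j)) where

  open EdgeList adj adj? public
  open Renaming σ σ σ-involutive σ-involutive public

  Reversed : Fin N × Fin N → Set
  Reversed (i , j) = (i < j × σ j < σ i) ⊎ (j < i × σ i < σ j)

  reversed? : ∀ x → Dec (Reversed x)
  reversed? (i , j) = ((i <? j) ×-dec (σ j <? σ i)) ⊎-dec ((j <? i) ×-dec (σ i <? σ j))

  σ-injective : ∀ {i j} → σ i ≡ σ j → i ≡ j
  σ-injective {i} {j} σi≡σj = trans (sym (σ-involutive i)) (trans (cong σ σi≡σj) (σ-involutive j))

  reversed-flip : ∀ {i j} → Reversed (i , j) → Reversed (σ j , σ i)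
  reversed-flip {i} {j} rev rewrite σ-involutive i | σ-involutive j with rev
  ... | inj₁ (i<j , σj<σi) = inj₁ (σj<σi , i<j)
  ... | inj₂ (j<i , σi<σj) = inj₂ (σi<σj , j<i)

  reversed-σ⁻ : ∀ {i j} → Reversed (σ i , σ j) → Reversed (i , j)
  reversed-σ⁻ {i} {j} rev rewrite σ-involutive i | σ-involutive j with rev
  ... | inj₁ (σi<σj , j<i) = inj₂ (j<i , σi<σj)
  ... | inj₂ (σj<σi , i<j) = inj₁ (i<j , σj<σi)

  -- Reorienting first makes σ send increasing pairs to increasing pairs.
  reflectEdge : Fin N × Fin N → Fin N × Fin N
  reflectEdge x = map× σ σ (swapWhen reversed? x)

  reflectEdge-involutive : ∀ x → reflectEdge (reflectEdge x) ≡ x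
  reflectEdge-involutive (i , j) with reversed? (i , j)
  ... | yes rev with reversed? (σ j , σ i)
  ...   | yes _    = cong₂ _,_ (σ-involutive i) (σ-involutive j)
  ...   | no ¬rev′ = ⊥-elim (¬rev′ (reversed-flip rev))
  reflectEdge-involutive (i , j) | no ¬rev with reversed? (σ i , σ j)
  ...   | yes rev′ = ⊥-elim (¬rev (reversed-σ⁻ rev′))
  ...   | no _     = cong₂ _,_ (σ-involutive i) (σ-involutive j)

  reflectEdge-∈ : ∀ {x} → x ∈ edges → reflectEdge x ∈ edges
  reflectEdge-∈ {i , j} x∈ with ∈-edges⁻ x∈ | reversed? (i , j)
  ... | i<j , ij | yes (inj₁ (_ , σj<σi)) = ∈-edges⁺ σj<σi (adj-sym (σ-adj ij))
  ... | i<j , ij | yes (inj₂ (j<i , _))   = ⊥-elim (<-asym i<j j<i)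
  ... | i<j , ij | no ¬rev with <-cmp (σ i) (σ j)
  ...   | tri< σi<σj _ _ = ∈-edges⁺ σi<σj (σ-adj ij)
  ...   | tri≈ _ σi≡σj _ = ⊥-elim (<-irrefl (σ-injective σi≡σj) i<j)
  ...   | tri> _ _ σj<σi = ⊥-elim (¬rev (inj₁ (i<j , σj<σi)))

  -- σ permutes the factors of the graph polynomial, flipping the sign of each reversed one.
  edgeCoeff-reflect : ∀ d → rename d ≡ d →
                      edgeCoeff d edges ≡ -1ℤ ^ length (filter reversed? edges) *ℤ edgeCoeff d edges
  edgeCoeff-reflect d d-invariant = begin
    edgeCoeff d edges
      ≡⟨ edgeCoeff-↭ (map-involution-↭ reflectEdge-involutive edges-unique reflectEdge-∈) d ⟨
    edgeCoeff d (map reflectEdge edges)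
      ≡⟨ cong (edgeCoeff d) (map-∘ edges) ⟩
    edgeCoeff d (map (map× σ σ) (map (swapWhen reversed?) edges))
      ≡⟨ cong (λ e → edgeCoeff e (map (map× σ σ) (map (swapWhen reversed?) edges))) d-invariant ⟨
    edgeCoeff (rename d) (map (map× σ σ) (map (swapWhen reversed?) edges))
      ≡⟨ edgeCoeff-rename (map (swapWhen reversed?) edges) d ⟩
    edgeCoeff d (map (swapWhen reversed?) edges)
      ≡⟨ edgeCoeff-swapWhen reversed? edges d ⟩
    -1ℤ ^ length (filter reversed? edges) *ℤ edgeCoeff d edges ∎
    where open ≡-Reasoning

-- Cycles and the toroidal grid

module _ {m n : ℕ} where

  combine-monoʳ-< : ∀ (u : Fin m) {v w : Fin n} → v < w → combine u v < combine u w
  combine-monoʳ-< u {v} {w} v<w =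
    subst₂ ℕ._<_ (sym (toℕ-combine u v)) (sym (toℕ-combine u w)) (ℕₚ.+-monoʳ-< (n ℕ.* toℕ u) v<w)

  combine-cancelʳ-< : ∀ (u : Fin m) {v w : Fin n} → combine u v < combine u w → v < w
  combine-cancelʳ-< u {v} {w} lt =
    ℕₚ.+-cancelˡ-< (n ℕ.* toℕ u) _ _ (subst₂ ℕ._<_ (toℕ-combine u v) (toℕ-combine u w) lt)

  combine-cancelˡ-< : ∀ {u u′ : Fin m} (v : Fin n) → combine u v < combine u′ v → u < u′
  combine-cancelˡ-< {u} {u′} v lt with <-cmp u u′
  ... | tri< u<u′ _ _ = u<u′
  ... | tri≈ _ refl _ = ⊥-elim (<-irrefl refl lt)
  ... | tri> _ _ u′<u = ⊥-elim (<-asym lt (combine-monoˡ-< v v u′<u))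

opposite-< : ∀ {n} {v w : Fin n} → v < w → opposite w < opposite v
opposite-< {v = v} {w} v<w =
  subst₂ ℕ._<_ (sym (opposite-prop w)) (sym (opposite-prop v)) (ℕₚ.∸-monoʳ-< (s≤s v<w) (toℕ<n w))

module _ {k : ℕ} where

  next : Fin (suc k) → Fin (suc k)
  next v = fromℕ< (m%n<n (suc (toℕ v)) (suc k))

  toℕ-next : ∀ v → toℕ (next v) ≡ suc (toℕ v) % suc k
  toℕ-next v = toℕ-fromℕ< (m%n<n (suc (toℕ v)) (suc k))

  toℕ-next-cases : ∀ v → (toℕ v ℕ.< k × toℕ (next v) ≡ suc (toℕ v))
                        ⊎ (toℕ v ≡ k × toℕ (next v) ≡ 0)
  toℕ-next-cases v with ℕₚ.m≤n⇒m<n∨m≡n (ℕₚ.≤-pred (toℕ<n v))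
  ... | inj₁ v<k  = inj₁ (v<k , trans (toℕ-next v) (m<n⇒m%n≡m (s≤s v<k)))
  ... | inj₂ v≡k  =
    inj₂ (v≡k , trans (toℕ-next v) (trans (cong (λ t → suc t % suc k) v≡k) (n%n≡0 (suc k))))

  next-≢ : 1 ℕ.≤ k → ∀ v → next v ≢ v
  next-≢ 1≤k v eq with toℕ-next-cases v
  ... | inj₁ (_ , succ)    = ℕₚ.1+n≢n (trans (sym succ) (cong toℕ eq))
  ... | inj₂ (v≡k , wrap) = ℕₚ.<⇒≢ 1≤k (trans (sym (trans (sym (cong toℕ eq)) wrap)) v≡k)

  next²-≢ : 2 ℕ.≤ k → ∀ v → next (next v) ≢ v
  next²-≢ 2≤k v eq with toℕ-next-cases v | toℕ-next-cases (next v)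
  ... | inj₁ (_ , succ) | inj₁ (_ , succ′) =
    2+n≢n (trans (sym (trans succ′ (cong suc succ))) (cong toℕ eq))
    where
    2+n≢n : ∀ {t} → suc (suc t) ≢ t
    2+n≢n {suc t} e = 2+n≢n (ℕₚ.suc-injective e)
  ... | inj₁ (_ , succ) | inj₂ (next≡k , wrap′) =
    ℕₚ.>⇒≢ 2≤k (trans (sym next≡k) (trans succ (cong suc (trans (sym (cong toℕ eq)) wrap′))))
  ... | inj₂ (v≡k , wrap) | inj₁ (_ , succ′) =
    ℕₚ.>⇒≢ 2≤k (trans (sym v≡k) (trans (sym (cong toℕ eq)) (trans succ′ (cong suc wrap))))
  ... | inj₂ (_ , wrap) | inj₂ (next≡k , _) =
    ℕₚ.>⇒≢ (ℕₚ.<-trans (s≤s z≤n) 2≤k) (trans (sym next≡k) wrap)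

  next-opposite : ∀ v → next (opposite (next v)) ≡ opposite v
  next-opposite v = toℕ-injective (begin
    toℕ (next (opposite (next v)))        ≡⟨ toℕ-next (opposite (next v)) ⟩
    suc (toℕ (opposite (next v))) % suc k ≡⟨ cong (λ t → suc t % suc k) (opposite-prop (next v)) ⟩
    suc (k ∸ toℕ (next v)) % suc k        ≡⟨ reflected-successor (toℕ-next-cases v) ⟩
    k ∸ toℕ v                             ≡⟨ opposite-prop v ⟨
    toℕ (opposite v)                      ∎)
    where
    open ≡-Reasoning
    reflected-successor : ∀ {t s} → (t ℕ.< k × s ≡ suc t) ⊎ (t ≡ k × s ≡ 0) →
                          suc (k ∸ s) % suc k ≡ k ∸ t
    reflected-successor {t} (inj₁ (t<k , refl)) =
      trans (cong (_% suc k) (sym (ℕₚ.+-∸-assoc 1 t<k))) (m<n⇒m%n≡m (s≤s (ℕₚ.m∸n≤m k t)))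
    reflected-successor (inj₂ (refl , refl)) = trans (n%n≡0 (suc k)) (sym (ℕₚ.n∸n≡0 k))

  cycleAdj-next : ∀ v → CycleAdj (suc k) v (next v)
  cycleAdj-next v = inj₁ (toℕ-next v)

  cycleAdj⇒next : ∀ {v w} → CycleAdj (suc k) v w → w ≡ next v ⊎ v ≡ next w
  cycleAdj⇒next {v} {w} (inj₁ w-succ) = inj₁ (toℕ-injective (trans w-succ (sym (toℕ-next v))))
  cycleAdj⇒next {v} {w} (inj₂ v-succ) = inj₂ (toℕ-injective (trans v-succ (sym (toℕ-next w))))

  cycleAdj-opposite : ∀ {v w} → CycleAdj (suc k) v w → CycleAdj (suc k) (opposite v) (opposite w)
  cycleAdj-opposite {v} {w} vw with cycleAdj⇒next vw
  ... | inj₁ refl = inj₂ (trans (cong toℕ (sym (next-opposite v))) (toℕ-next (opposite w)))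
  ... | inj₂ refl = inj₁ (trans (cong toℕ (sym (next-opposite w))) (toℕ-next (opposite v)))

cycleAdj-sym : ∀ {k} {v w : Fin k} → CycleAdj k v w → CycleAdj k w v
cycleAdj-sym (inj₁ e) = inj₂ e
cycleAdj-sym (inj₂ e) = inj₁ e

module _ {n : ℕ} where

  sortPair : Fin n × Fin n → Fin n × Fin n
  sortPair = swapWhen (λ x → proj₂ x <? proj₁ x)

  sortPair-< : ∀ {i j} → i < j → sortPair (i , j) ≡ (i , j)
  sortPair-< {i} {j} i<j with j <? i
  ... | yes j<i = ⊥-elim (<-asym i<j j<i)
  ... | no  _   = refl

  sortPair-> : ∀ {i j} → j < i → sortPair (i , j) ≡ (j , i)
  sortPair-> {i} {j} j<i with j <? i
  ... | yes _   = refl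
  ... | no j≮i = ⊥-elim (j≮i j<i)

module Torus (a k : ℕ) (2≤k : 2 ℕ.≤ k) where

  b : ℕ
  b = suc k

  V : Set
  V = Fin (a ℕ.* b)

  row : V → Fin a
  row i = proj₁ (remQuot {a} b i)

  col : V → Fin b
  col i = proj₂ (remQuot {a} b i)

  row-combine : ∀ (u : Fin a) (v : Fin b) → row (combine u v) ≡ u
  row-combine u v = cong proj₁ (remQuot-combine u v)

  col-combine : ∀ (u : Fin a) (v : Fin b) → col (combine u v) ≡ v
  col-combine u v = cong proj₂ (remQuot-combine u v)

  combine-row-col : ∀ i → combine (row i) (col i) ≡ i
  combine-row-col i = combine-remQuot {a} b i

  vertex-≡ : ∀ {i j} → row i ≡ row j → col i ≡ col j → i ≡ j
  vertex-≡ {i} {j} r c = trans (sym (combine-row-col i)) (trans (cong₂ combine r c) (combine-row-col j))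

  adj : V → V → Set
  adj = TorusAdj a b

  adj-sym : ∀ {i j} → adj i j → adj j i
  adj-sym (inj₁ (r , c)) = inj₁ (sym r , cycleAdj-sym c)
  adj-sym (inj₂ (c , r)) = inj₂ (sym c , cycleAdj-sym r)

  reflect : V → V
  reflect i = combine (row i) (opposite (col i))

  row-reflect : ∀ i → row (reflect i) ≡ row i
  row-reflect i = row-combine (row i) (opposite (col i))

  col-reflect : ∀ i → col (reflect i) ≡ opposite (col i)
  col-reflect i = col-combine (row i) (opposite (col i))

  reflect-involutive : ∀ i → reflect (reflect i) ≡ i
  reflect-involutive i = vertex-≡ (trans (row-reflect (reflect i)) (row-reflect i))
    (trans (col-reflect (reflect i)) (trans (cong opposite (col-reflect i)) (opposite-involutive (col i))))

  reflect-adj : ∀ {i j} → adj i j → adj (reflect i) (reflect j)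
  reflect-adj {i} {j} (inj₁ (r , c)) rewrite row-reflect i | row-reflect j | col-reflect i | col-reflect j =
    inj₁ (r , cycleAdj-opposite c)
  reflect-adj {i} {j} (inj₂ (c , r)) rewrite row-reflect i | row-reflect j | col-reflect i | col-reflect j =
    inj₂ (cong opposite c , r)

  <-via-combine : ∀ {i j} → i < j → combine (row i) (col i) < combine (row j) (col j)
  <-via-combine {i} {j} = subst₂ _<_ (sym (combine-row-col i)) (sym (combine-row-col j))

  reflect-sameRow : ∀ {i j} → row i ≡ row j → i < j → reflect j < reflect i
  reflect-sameRow {i} {j} r i<j = subst (λ u → combine u (opposite (col j)) < reflect i) r
    (combine-monoʳ-< (row i) (opposite-< (combine-cancelʳ-< (row i)
      (subst (λ u → combine (row i) (col i) < combine u (col j)) (sym r) (<-via-combine i<j)))))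

  reflect-sameCol : ∀ {i j} → col i ≡ col j → i < j → reflect i < reflect j
  reflect-sameCol {i} {j} c i<j = combine-monoˡ-< {i = row i} {row j} (opposite (col i)) (opposite (col j))
    (combine-cancelˡ-< {u = row i} {row j} (col i)
      (subst (λ v → combine (row i) (col i) < combine (row j) v) (sym c) (<-via-combine i<j)))

  open Reflection adj (torusAdj? a b) adj-sym reflect reflect-involutive reflect-adj public

  right : V → V
  right i = combine (row i) (next (col i))

  row-right : ∀ i → row (right i) ≡ row i
  row-right i = row-combine (row i) (next (col i))

  col-right : ∀ i → col (right i) ≡ next (col i)
  col-right i = col-combine (row i) (next (col i))

  adj-right : ∀ i → adj i (right i)
  adj-right i =
    inj₁ (sym (row-right i) , subst (CycleAdj b (col i)) (sym (col-right i)) (cycleAdj-next (col i)))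

  right-≢ : ∀ i → right i ≢ i
  right-≢ i eq = next-≢ (ℕₚ.<⇒≤ 2≤k) (col i) (trans (sym (col-right i)) (cong col eq))

  right²-≢ : ∀ i → right (right i) ≢ i
  right²-≢ i eq = next²-≢ 2≤k (col i)
    (trans (cong next (sym (col-right i))) (trans (sym (col-right (right i))) (cong col eq)))

  rowEdge : V → V × V
  rowEdge i = sortPair (i , right i)

  rowEdge-cases : ∀ i → (rowEdge i ≡ (i , right i) × i < right i)
                      ⊎ (rowEdge i ≡ (right i , i) × right i < i)
  rowEdge-cases i with <-cmp i (right i)
  ... | tri< i<r _ _ = inj₁ (sortPair-< i<r , i<r)
  ... | tri≈ _ i≡r _ = ⊥-elim (right-≢ i (sym i≡r))
  ... | tri> _ _ r<i = inj₂ (sortPair-> r<i , r<i)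

  rowEdge-reversed : ∀ i → rowEdge i ∈ filter reversed? edges
  rowEdge-reversed i with rowEdge-cases i
  ... | inj₁ (eq , i<r) rewrite eq =
    ∈-filter⁺ reversed? (∈-edges⁺ i<r (adj-right i))
              (inj₁ (i<r , reflect-sameRow (sym (row-right i)) i<r))
  ... | inj₂ (eq , r<i) rewrite eq =
    ∈-filter⁺ reversed? (∈-edges⁺ r<i (adj-sym (adj-right i)))
              (inj₁ (r<i , reflect-sameRow (row-right i) r<i))

  rowEdge-uncrossed : ∀ {i j} → (i , right i) ≢ (right j , j)
  rowEdge-uncrossed {i} {j} eq = right²-≢ j (trans (cong right (sym (cong proj₁ eq))) (cong proj₂ eq))

  rowEdge-injective : ∀ {i i′} → rowEdge i ≡ rowEdge i′ → i ≡ i′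
  rowEdge-injective {i} {i′} eq with rowEdge-cases i | rowEdge-cases i′
  ... | inj₁ (e , _) | inj₁ (e′ , _) = cong proj₁ (trans (sym e) (trans eq e′))
  ... | inj₂ (e , _) | inj₂ (e′ , _) = cong proj₂ (trans (sym e) (trans eq e′))
  ... | inj₁ (e , _) | inj₂ (e′ , _) = ⊥-elim (rowEdge-uncrossed (trans (sym e) (trans eq e′)))
  ... | inj₂ (e , _) | inj₁ (e′ , _) = ⊥-elim (rowEdge-uncrossed (sym (trans (sym e) (trans eq e′))))

  reversed⇒sameRow : ∀ {i j} → (i , j) ∈ edges → Reversed (i , j) →
                     row i ≡ row j × CycleAdj b (col i) (col j)
  reversed⇒sameRow x∈ rev with ∈-edges⁻ x∈ | rev
  ... | i<j , _               | inj₂ (j<i , _)    = ⊥-elim (<-asym i<j j<i)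
  ... | _   , inj₁ sameRow    | inj₁ _            = sameRow
  ... | i<j , inj₂ (c , _)    | inj₁ (_ , σj<σi) = ⊥-elim (<-asym σj<σi (reflect-sameCol c i<j))

  rowNeighbours : ∀ {i j} → row i ≡ row j → CycleAdj b (col i) (col j) → j ≡ right i ⊎ i ≡ right j
  rowNeighbours {i} {j} r c with cycleAdj⇒next c
  ... | inj₁ cj≡ = inj₁ (vertex-≡ (trans (sym r) (sym (row-right i))) (trans cj≡ (sym (col-right i))))
  ... | inj₂ ci≡ = inj₂ (vertex-≡ (trans r (sym (row-right j))) (trans ci≡ (sym (col-right j))))

  ∈-rowEdges : ∀ {i j} → i < j → j ≡ right i ⊎ i ≡ right j → (i , j) ∈ map rowEdge (allFin (a ℕ.* b))
  ∈-rowEdges {i} i<j (inj₁ refl) =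
    subst (_∈ map rowEdge (allFin _)) (sortPair-< i<j) (∈-map⁺ rowEdge (∈-allFin i))
  ∈-rowEdges {j = j} i<j (inj₂ refl) =
    subst (_∈ map rowEdge (allFin _)) (sortPair-> i<j) (∈-map⁺ rowEdge (∈-allFin j))

  reversedEdges↭rowEdges : filter reversed? edges ↭ map rowEdge (allFin (a ℕ.* b))
  reversedEdges↭rowEdges =
    ∼bag⇒↭ (unique∧set⇒bag (filter⁺ reversed? edges-unique) (map⁺ rowEdge-injective (allFin⁺ _))
                           (mk⇔ reversed⇒rowEdge rowEdge⇒reversed))
    where
    reversed⇒rowEdge : ∀ {x} → x ∈ filter reversed? edges → x ∈ map rowEdge (allFin _)
    reversed⇒rowEdge x∈ with ∈-filter⁻ reversed? {xs = edges} x∈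
    ... | x∈E , rev =
      ∈-rowEdges (proj₁ (∈-edges⁻ x∈E)) (uncurry rowNeighbours (reversed⇒sameRow x∈E rev))

    rowEdge⇒reversed : ∀ {x} → x ∈ map rowEdge (allFin _) → x ∈ filter reversed? edges
    rowEdge⇒reversed x∈ with ∈-map⁻ rowEdge x∈
    ... | i , _ , refl = rowEdge-reversed i

  length-reversedEdges : length (filter reversed? edges) ≡ a ℕ.* b
  length-reversedEdges = trans (↭-length reversedEdges↭rowEdges)
                               (trans (length-map rowEdge (allFin _)) (length-tabulate (λ i → i)))

i≡-i⇒i≡0 : ∀ {x} → x ≡ - x → x ≡ + 0
i≡-i⇒i≡0 {+ 0}        _ = refl
i≡-i⇒i≡0 {+ suc _}    ()
i≡-i⇒i≡0 {(-[1+ _ ])} ()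

-1^odd : ∀ k → -1ℤ ^ suc (2 * k) ≡ -1ℤ
-1^odd k = cong (-1ℤ *ℤ_) (trans (sym (ℤₚ.^-*-assoc -1ℤ 2 k)) (ℤₚ.^-zeroˡ k))

torusPoly-coeff-replicate≡0 : ∀ a b → 3 ≤ b → ∀ c k → a * b ≡ suc (2 * k) →
                              coeff (replicate (a * b) c) (torusPoly a b) ≡ + 0
torusPoly-coeff-replicate≡0 a (suc b′) (s≤s 2≤b′) c k ab-odd =
  trans (coeff-binomialProduct d edges) (i≡-i⇒i≡0 (begin
    x                                          ≡⟨ edgeCoeff-reflect d (rename-replicate c) ⟩
    -1ℤ ^ length (filter reversed? edges) *ℤ x  ≡⟨ cong (λ n → -1ℤ ^ n *ℤ x) length-reversed ⟩
    -1ℤ ^ suc (2 * k) *ℤ x                     ≡⟨ cong (_*ℤ x) (-1^odd k) ⟩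
    -1ℤ *ℤ x                                   ≡⟨ ℤₚ.-1*i≡-i x ⟩
    - x                                        ∎))
  where
  open Torus a b′ 2≤b′
  open ≡-Reasoning
  d : Monomial (a * suc b′)
  d = replicate (a * suc b′) c

  x : ℤ
  x = edgeCoeff d edges

  length-reversed : length (filter reversed? edges) ≡ suc (2 * k)
  length-reversed = trans length-reversedEdges ab-odd

mainTheorem5 : (m n : ℕ) → m ≥ 1 → n ≥ 1 →
    coeff (replicate ((2 * m + 1) * (2 * n + 1)) 2) (torusPoly (2 * m + 1) (2 * n + 1))
      ≡ Data.Integer.+ 0
mainTheorem5 m n _ n≥1 =
  torusPoly-coeff-replicate≡0 (2 * m + 1) (2 * n + 1) 3≤2n+1 2 (2 * m * n + m + n) (odd m n)
  where
  3≤2n+1 : 3 ≤ 2 * n + 1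
  3≤2n+1 = ℕₚ.+-monoˡ-≤ 1 (ℕₚ.*-monoʳ-≤ 2 n≥1)

  odd : ∀ m n → (2 * m + 1) * (2 * n + 1) ≡ suc (2 * (2 * m * n + m + n))
  odd = ℕ-Solver.solve-∀
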